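{- Let $S$ be a finite, non-vertical set of at least two points in general position in the plane, and let $U_S, L_S$ be its upper and lower subsets (defined in the context). Then $S = U_S \cup L_S$, $U_S \cap L_S = \emptyset$, and both $U_S$ and $L_S$ are nonempty.
   Context: A set is in general position if no three of its points are collinear, and non-vertical if no vertical line contains two of its points. For a point $p$ write $p=(p_x,p_y)$. For $s \in S$ let $S_s^- = \{s' \in S : s'_x < s_x\}$ and $S_s^+ = S \setminus (S_s^- \cup \{s\})$. For $s' \in S\setminus\{s\}$ define $\angle(s,s')$ as the angle $\angle(s', s, (s_x, s_y+1))$ if $s' \in S_s^-$, and as the angle $\angle((s_x,s_y-1), s, s')$ if $s' \in S_s^+$. Let $p_s$ be the (unique, by general position) point of $S\setminus\{s\}$ minimizing $\angle(s,\cdot)$. The point $s$ is an upper point of $S$ if $p_s \in S_s^+$ and a lower point otherwise; $U_S$ is the set of upper points and $L_S$ the set of lower points of $S$. -}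

module Defs where

open import Level using (Level; _⊔_) renaming (suc to lsuc)
open import Algebra.Bundles using (CommutativeRing)
open import Relation.Binary.Core using (Rel)
open import Relation.Binary.Structures using (IsStrictTotalOrder)
open import Relation.Binary.PropositionalEquality using (_≡_; _≢_)
open import Relation.Nullary using (¬_)
open import Data.Product using (_×_; Σ; ∃; _,_)
open import Data.Sum using (_⊎_)
open import Data.List using (List)
open import Data.List.Membership.Propositional using (_∈_)
open import Data.List.Relation.Unary.AllPairs using (AllPairs)

record OrderedField (c ℓ₁ ℓ₂ : Level) : Set (lsuc (c ⊔ ℓ₁ ⊔ ℓ₂)) where
  field
    commutativeRing : CommutativeRing c ℓ₁
  open CommutativeRing commutativeRing public
  infix 4 _<_
  field
    _<_                : Rel Carrier ℓ₂
    isStrictTotalOrder : IsStrictTotalOrder _≈_ _<_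
    +-monoˡ-<          : ∀ z {x y} → x < y → (x + z) < (y + z)
    *-pos              : ∀ {x y} → 0# < x → 0# < y → 0# < (x * y)
    0<1                : 0# < 1#
    inverse            : ∀ x → ¬ (x ≈ 0#) → ∃ λ y → (x * y) ≈ 1#

module Plane {c ℓ₁ ℓ₂ : Level} (F : OrderedField c ℓ₁ ℓ₂) where
  open OrderedField F

  Point : Set c
  Point = Carrier × Carrier

  px : Point → Carrier
  px (a , _) = a

  py : Point → Carrier
  py (_ , b) = b

  cross : Point → Point → Point → Carrier
  cross a b d = ((px b - px a) * (py d - py a)) - ((py b - py a) * (px d - px a))

  Collinear : Point → Point → Point → Set ℓ₁
  Collinear a b d = cross a b d ≈ 0#

  -- no vertical line contains two points of S (this also makes the points distinct)
  NonVertical : List Point → Set (c ⊔ ℓ₁)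
  NonVertical S = AllPairs (λ p q → ¬ (px p ≈ px q)) S

  GeneralPosition : List Point → Set (c ⊔ ℓ₁)
  GeneralPosition S = ∀ {a b d} → a ∈ S → b ∈ S → d ∈ S →
    a ≢ b → b ≢ d → a ≢ d → ¬ Collinear a b d

  LeftOf : Point → Point → Set ℓ₂
  LeftOf s s' = px s' < px s

  RightOf : Point → Point → Set ℓ₂
  RightOf s s' = px s < px s'

  -- AngleLt s p q  :⇔  ∠(s,p) < ∠(s,q).
  -- ∠(s,p) is the angle of p - s from the upward vertical (p left of s) or
  -- from the downward vertical (p right of s); both lie in (0,π).  Mapping a
  -- left vector v to -v, both angles become angles from the downward
  -- vertical in the right half plane, where a smaller angle means the other
  -- vector is counter-clockwise, i.e. a positive cross product.
  AngleLt : Point → Point → Point → Set (ℓ₂)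
  AngleLt s p q =
      (RightOf s p × RightOf s q × (0# < cross s p q))
    ⊎ (LeftOf  s p × LeftOf  s q × (0# < cross s p q))
    ⊎ (RightOf s p × LeftOf  s q × (cross s p q < 0#))
    ⊎ (LeftOf  s p × RightOf s q × (cross s p q < 0#))

  IsMinimizer : List Point → Point → Point → Set (c ⊔ ℓ₂)
  IsMinimizer S s p = p ∈ S × p ≢ s ×
    (∀ {q} → q ∈ S → q ≢ s → q ≢ p → AngleLt s p q)

  Upper : List Point → Point → Set (c ⊔ ℓ₂)
  Upper S s = s ∈ S × Σ Point (λ p → IsMinimizer S s p × RightOf s p)

  Lower : List Point → Point → Set (c ⊔ ℓ₂)
  Lower S s = s ∈ S × Σ Point (λ p → IsMinimizer S s p × ¬ RightOf s p)

{-# OPTIONS --safe #-}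
module Submission where

-- Seen from s, the angle ∠(s,p) is an increasing function of the slope of the
-- line sp, on either side of s.  Clearing denominators, ∠(s,p) < ∠(s,q) becomes
-- 0 < (pₓ − sₓ)(qₓ − sₓ) · cross(s,p,q), a transitive and asymmetric relation
-- that general position makes total on S ∖ {s}; hence p_s exists and is unique,
-- so every point is upper or lower but not both.  The leftmost point of S sees
-- every other point, p_s included, on its right, so it is upper; symmetrically
-- the rightmost point is lower.

open import Defs
open import Level using (Level; _⊔_)
open import Function using (_∘_; flip)
open import Data.Nat using (_≤_; s≤s)
open import Data.List using (List; []; _∷_; length; filter)
open import Data.List.Membership.Propositional using (_∈_)
open import Data.List.Membership.Propositional.Properties using (∈-filter⁺; ∈-filter⁻)
open import Data.List.Relation.Unary.Any using (here; there)
open import Data.List.Relation.Unary.All using (_∷_)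
import Data.List.Relation.Unary.All as All
open import Data.List.Relation.Unary.AllPairs using (_∷_)
open import Data.Product using (_×_; _,_; proj₁; proj₂; ∃)
open import Data.Sum using (_⊎_; inj₁; inj₂)
import Data.Sum as Sum
import Data.Product as Product
open import Data.Empty using (⊥; ⊥-elim)
open import Relation.Nullary using (¬_; Dec; yes; no)
open import Relation.Nullary.Decidable using (¬?; map′)
open import Relation.Binary.Core using (Rel)
open import Relation.Binary.Definitions using (Transitive; Tri; tri<; tri≈; tri>)
open import Relation.Binary.Structures using (IsStrictTotalOrder)
open import Relation.Binary.PropositionalEquality using (_≡_; _≢_; refl; cong; subst)
import Algebra.Properties.AbelianGroup as AbelianGroupProperties
import Algebra.Properties.CommutativeSemigroup as CommutativeSemigroupProperties
import Algebra.Properties.Group as GroupProperties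
import Algebra.Properties.Ring as RingProperties
import Algebra.Solver.Ring.NaturalCoefficients.Default as NaturalCoefficientsSolver
import Relation.Binary.Reasoning.Setoid as SetoidReasoning

module OrderedFieldProperties {c ℓ₁ ℓ₂ : Level} (F : OrderedField c ℓ₁ ℓ₂) where
  open OrderedField F
  open IsStrictTotalOrder isStrictTotalOrder public
    using (compare; _≟_; _<?_; <-respˡ-≈; <-respʳ-≈)
    renaming (trans to <-trans; irrefl to <-irrefl; asym to <-asym)
  open RingProperties ring using (-‿distribˡ-*; -‿distribʳ-*)
  open GroupProperties +-group using (⁻¹-involutive)
  open CommutativeSemigroupProperties *-commutativeSemigroup using (interchange)

  x<y⇒0<y-x : ∀ {x y} → x < y → 0# < y - x
  x<y⇒0<y-x {x} x<y = <-respˡ-≈ (-‿inverseʳ x) (+-monoˡ-< (- x) x<y)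

  x<y⇒x-y<0 : ∀ {x y} → x < y → x - y < 0#
  x<y⇒x-y<0 {y = y} x<y = <-respʳ-≈ (-‿inverseʳ y) (+-monoˡ-< (- y) x<y)

  x<0⇒0<-x : ∀ {x} → x < 0# → 0# < - x
  x<0⇒0<-x x<0 = <-respʳ-≈ (+-identityˡ _) (x<y⇒0<y-x x<0)

  0<-x⇒x<0 : ∀ {x} → 0# < - x → x < 0#
  0<-x⇒x<0 {x} 0<-x = <-respʳ-≈ (-‿inverseˡ x) (<-respˡ-≈ (+-identityˡ x) (+-monoˡ-< x 0<-x))

  +-pos : ∀ {x y} → 0# < x → 0# < y → 0# < x + y
  +-pos {x} {y} 0<x 0<y = <-trans 0<y (<-respˡ-≈ (+-identityˡ y) (+-monoˡ-< y 0<x))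

  -x*-y≈x*y : ∀ x y → - x * - y ≈ x * y
  -x*-y≈x*y x y = trans (sym (-‿distribˡ-* x (- y)))
                        (trans (-‿cong (sym (-‿distribʳ-* x y))) (⁻¹-involutive (x * y)))

  *-neg-neg : ∀ {x y} → x < 0# → y < 0# → 0# < x * y
  *-neg-neg {x} {y} x<0 y<0 = <-respʳ-≈ (-x*-y≈x*y x y) (*-pos (x<0⇒0<-x x<0) (x<0⇒0<-x y<0))

  *-pos-neg : ∀ {x y} → 0# < x → y < 0# → x * y < 0#
  *-pos-neg {x} {y} 0<x y<0 =
    0<-x⇒x<0 (<-respʳ-≈ (sym (-‿distribʳ-* x y)) (*-pos 0<x (x<0⇒0<-x y<0)))

  *-neg-pos : ∀ {x y} → x < 0# → 0# < y → x * y < 0#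
  *-neg-pos {x} {y} x<0 0<y = <-respˡ-≈ (*-comm y x) (*-pos-neg 0<y x<0)

  y≈0⇒x*y≈0 : ∀ x {y} → y ≈ 0# → x * y ≈ 0#
  y≈0⇒x*y≈0 x y≈0 = trans (*-congˡ y≈0) (zeroʳ x)

  *-cancelˡ-pos : ∀ {x y} → 0# < x → 0# < x * y → 0# < y
  *-cancelˡ-pos {x} {y} 0<x 0<xy with compare 0# y
  ... | tri< 0<y _ _ = 0<y
  ... | tri≈ _ 0≈y _ = ⊥-elim (<-irrefl (sym (y≈0⇒x*y≈0 x (sym 0≈y))) 0<xy)
  ... | tri> _ _ y<0 = ⊥-elim (<-asym 0<xy (*-pos-neg 0<x y<0))

  *-cancelˡ-neg : ∀ {x y} → x < 0# → 0# < x * y → y < 0#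
  *-cancelˡ-neg {x} {y} x<0 0<xy with compare 0# y
  ... | tri< 0<y _ _ = ⊥-elim (<-asym 0<xy (*-neg-pos x<0 0<y))
  ... | tri≈ _ 0≈y _ = ⊥-elim (<-irrefl (sym (y≈0⇒x*y≈0 x (sym 0≈y))) 0<xy)
  ... | tri> _ _ y<0 = y<0

  x≉0⇒0<x*x : ∀ {x} → ¬ x ≈ 0# → 0# < x * x
  x≉0⇒0<x*x {x} x≉0 with compare 0# x
  ... | tri< 0<x _ _ = *-pos 0<x 0<x
  ... | tri≈ _ 0≈x _ = ⊥-elim (x≉0 (sym 0≈x))
  ... | tri> _ _ x<0 = *-neg-neg x<0 x<0

  *-nonzero : ∀ {x y} → ¬ x ≈ 0# → ¬ y ≈ 0# → ¬ x * y ≈ 0#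
  *-nonzero {x} {y} x≉0 y≉0 xy≈0 =
    <-irrefl (sym xxyy≈0) (*-pos (x≉0⇒0<x*x x≉0) (x≉0⇒0<x*x y≉0))
    where
    xxyy≈0 : (x * x) * (y * y) ≈ 0#
    xxyy≈0 = trans (interchange x x y y) (y≈0⇒x*y≈0 (x * y) xy≈0)

module SlopeOrder {c ℓ₁ ℓ₂ : Level} (F : OrderedField c ℓ₁ ℓ₂) where
  open OrderedField F renaming (refl to ≈-refl)
  open Plane F using (Point; px; py)
  open OrderedFieldProperties F
  open RingProperties ring using (-‿distribˡ-*; -‿distribʳ-*)
  open AbelianGroupProperties +-abelianGroup using (⁻¹-anti-homo‿-)
  open SetoidReasoning setoid
  open NaturalCoefficientsSolver commutativeSemiring using (solve; _:=_; _:+_; _:*_)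

  det : Point → Point → Carrier
  det u v = px u * py v - py u * px v

  -- (px u * px v)² · (py v / px v − py u / px u): the comparison of the slopes of
  -- u and v with the denominators cleared
  slopeDiff : Point → Point → Carrier
  slopeDiff u v = (px u * px v) * det u v

  det-antisym : ∀ u v → det v u ≈ - det u v
  det-antisym u v = begin
    px v * py u - py v * px u     ≈⟨ +-cong (*-comm (px v) (py u)) (-‿cong (*-comm (py v) (px u))) ⟩
    py u * px v - px u * py v     ≈⟨ ⁻¹-anti-homo‿- (px u * py v) (py u * px v) ⟨
    - det u v                     ∎

  -- the three-term Grassmann–Plücker relation; the negated coordinates are
  -- treated as atoms so that the semiring solver applies
  det-plücker : ∀ a b c → px a * det b c + px c * det a b ≈ px b * det a c
  det-plücker (a₁ , a₂) (b₁ , b₂) (c₁ , c₂) = begin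
    a₁ * (b₁ * c₂ - b₂ * c₁) + c₁ * (a₁ * b₂ - a₂ * b₁)
      ≈⟨ +-cong (*-congˡ (+-congˡ (-‿distribˡ-* b₂ c₁))) (*-congˡ (+-congˡ (-‿distribˡ-* a₂ b₁))) ⟩
    a₁ * (b₁ * c₂ + - b₂ * c₁) + c₁ * (a₁ * b₂ + - a₂ * b₁)
      ≈⟨ solve 8 (λ a₁ a₂ b₁ b₂ c₁ c₂ -a₂ -b₂ →
             a₁ :* (b₁ :* c₂ :+ -b₂ :* c₁) :+ c₁ :* (a₁ :* b₂ :+ -a₂ :* b₁)
          := b₁ :* (a₁ :* c₂ :+ -a₂ :* c₁) :+ a₁ :* c₁ :* (-b₂ :+ b₂))
          ≈-refl a₁ a₂ b₁ b₂ c₁ c₂ (- a₂) (- b₂) ⟩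
    b₁ * (a₁ * c₂ + - a₂ * c₁) + a₁ * c₁ * (- b₂ + b₂)
      ≈⟨ +-congˡ (y≈0⇒x*y≈0 (a₁ * c₁) (-‿inverseˡ b₂)) ⟩
    b₁ * (a₁ * c₂ + - a₂ * c₁) + 0#
      ≈⟨ +-identityʳ _ ⟩
    b₁ * (a₁ * c₂ + - a₂ * c₁)
      ≈⟨ *-congˡ (+-congˡ (-‿distribˡ-* a₂ c₁)) ⟨
    b₁ * (a₁ * c₂ - a₂ * c₁)
      ∎

  slopeDiff-antisym : ∀ u v → slopeDiff v u ≈ - slopeDiff u v
  slopeDiff-antisym u v = begin
    (px v * px u) * det v u     ≈⟨ *-cong (*-comm (px v) (px u)) (det-antisym u v) ⟩
    (px u * px v) * - det u v   ≈⟨ -‿distribʳ-* (px u * px v) (det u v) ⟨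
    - slopeDiff u v             ∎

  slopeDiff-trans-identity : ∀ a b c →
    (px b * px b) * slopeDiff a c ≈ (px a * px a) * slopeDiff b c + (px c * px c) * slopeDiff a b
  slopeDiff-trans-identity a b c = begin
    (px b * px b) * ((px a * px c) * det a c)
      ≈⟨ solve 4 (λ a₁ b₁ c₁ d → (b₁ :* b₁) :* ((a₁ :* c₁) :* d) := (a₁ :* b₁ :* c₁) :* (b₁ :* d))
                 ≈-refl (px a) (px b) (px c) (det a c) ⟩
    (px a * px b * px c) * (px b * det a c)
      ≈⟨ *-congˡ (det-plücker a b c) ⟨
    (px a * px b * px c) * (px a * det b c + px c * det a b)
      ≈⟨ solve 5 (λ a₁ b₁ c₁ d e →
             (a₁ :* b₁ :* c₁) :* (a₁ :* d :+ c₁ :* e)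
          := (a₁ :* a₁) :* ((b₁ :* c₁) :* d) :+ (c₁ :* c₁) :* ((a₁ :* b₁) :* e))
          ≈-refl (px a) (px b) (px c) (det b c) (det a b) ⟩
    (px a * px a) * slopeDiff b c + (px c * px c) * slopeDiff a b
      ∎

  0<slopeDiff⇒px≉0 : ∀ {u v} → 0# < slopeDiff u v → ¬ px u ≈ 0# × ¬ px v ≈ 0#
  0<slopeDiff⇒px≉0 {u} {v} 0<uv =
      (λ u≈0 → vanishes (trans (*-comm (px u) (px v)) (y≈0⇒x*y≈0 (px v) u≈0)))
    , (λ v≈0 → vanishes (y≈0⇒x*y≈0 (px u) v≈0))
    where
    vanishes : px u * px v ≈ 0# → ⊥
    vanishes e = <-irrefl (sym (trans (*-congʳ e) (zeroˡ (det u v)))) 0<uv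

  slopeDiff-trans : ∀ {a b c} → 0# < slopeDiff a b → 0# < slopeDiff b c → 0# < slopeDiff a c
  slopeDiff-trans {a} {b} {c} 0<ab 0<bc =
    *-cancelˡ-pos (x≉0⇒0<x*x b≉0)
      (<-respʳ-≈ (sym (slopeDiff-trans-identity a b c))
        (+-pos (*-pos (x≉0⇒0<x*x a≉0) 0<bc) (*-pos (x≉0⇒0<x*x c≉0) 0<ab)))
    where
    a≉0 : ¬ px a ≈ 0#
    a≉0 = proj₁ (0<slopeDiff⇒px≉0 0<ab)
    b≉0 : ¬ px b ≈ 0#
    b≉0 = proj₂ (0<slopeDiff⇒px≉0 0<ab)
    c≉0 : ¬ px c ≈ 0#
    c≉0 = proj₂ (0<slopeDiff⇒px≉0 0<bc)

  slopeDiff-asym : ∀ {u v} → 0# < slopeDiff u v → ¬ 0# < slopeDiff v u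
  slopeDiff-asym {u} {v} 0<uv 0<vu = <-asym 0<uv (0<-x⇒x<0 (<-respʳ-≈ (slopeDiff-antisym u v) 0<vu))

  slopeDiff-total : ∀ {u v} → ¬ px u ≈ 0# → ¬ px v ≈ 0# → ¬ det u v ≈ 0# →
    0# < slopeDiff u v ⊎ 0# < slopeDiff v u
  slopeDiff-total {u} {v} u≉0 v≉0 det≉0 with compare 0# (slopeDiff u v)
  ... | tri< 0<uv _ _ = inj₁ 0<uv
  ... | tri≈ _ 0≈uv _ = ⊥-elim (*-nonzero (*-nonzero u≉0 v≉0) det≉0 (sym 0≈uv))
  ... | tri> _ _ uv<0 = inj₂ (<-respʳ-≈ (sym (slopeDiff-antisym u v)) (x<0⇒0<-x uv<0))

module _ {a ℓ} {A : Set a} (_≺_ : Rel A ℓ) where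

  TrichotomousOn : List A → Set (a ⊔ ℓ)
  TrichotomousOn xs = ∀ {x y} → x ∈ xs → y ∈ xs → Tri (x ≺ y) (x ≡ y) (y ≺ x)

  Least : List A → A → Set (a ⊔ ℓ)
  Least xs m = m ∈ xs × (∀ {x} → x ∈ xs → x ≢ m → m ≺ x)

  least : Transitive _≺_ → ∀ {x xs} → x ∈ xs → TrichotomousOn xs → ∃ (Least xs)
  least _ {xs = x ∷ []} _ _ = x , here refl , λ { (here refl) x≢x → ⊥-elim (x≢x refl) }
  least ≺-trans {xs = x ∷ y ∷ ys} _ tri
    with least ≺-trans (here refl) (λ u∈ v∈ → tri (there u∈) (there v∈))
  ... | m , m∈ , m-least with tri (here refl) (there m∈)
  ... | tri≈ _ refl _ = x , here refl , λ
          { (here refl) x≢x → ⊥-elim (x≢x refl)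
          ; (there z∈) z≢x → m-least z∈ z≢x }
  ... | tri> _ _ m≺x = m , there m∈ , λ
          { (here refl) _ → m≺x
          ; (there z∈) z≢m → m-least z∈ z≢m }
  ... | tri< x≺m _ _ = x , here refl , λ
          { (here refl) x≢x → ⊥-elim (x≢x refl)
          ; (there z∈) _ → x≺ z∈ }
    where
    x≺ : ∀ {z} → z ∈ y ∷ ys → x ≺ z
    x≺ z∈ with tri (there z∈) (there m∈)
    ... | tri≈ _ refl _ = x≺m
    ... | tri< _ z≢m _ = ≺-trans x≺m (m-least z∈ z≢m)
    ... | tri> _ z≢m _ = ≺-trans x≺m (m-least z∈ z≢m)

TrichotomousOn-flip : ∀ {a ℓ} {A : Set a} {_≺_ : Rel A ℓ} {xs} →
  TrichotomousOn _≺_ xs → TrichotomousOn (flip _≺_) xs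
TrichotomousOn-flip tri x∈ y∈ with tri x∈ y∈
... | tri< x≺y x≢y y⊀x = tri> y⊀x x≢y x≺y
... | tri≈ x⊀y x≡y y⊀x = tri≈ y⊀x x≡y x⊀y
... | tri> x⊀y x≢y y≺x = tri< y≺x x≢y x⊀y

module AngleOrder {c ℓ₁ ℓ₂ : Level} (F : OrderedField c ℓ₁ ℓ₂) where
  open OrderedField F
  open Plane F
  open OrderedFieldProperties F
  open SlopeOrder F
  open GroupProperties +-group using (x∙y⁻¹≈ε⇒x≈y; x≈y⇒x∙y⁻¹≈ε)

  _⊖_ : Point → Point → Point
  p ⊖ s = px p - px s , py p - py s

  side : ∀ {s p} → ¬ px p ≈ px s → RightOf s p ⊎ LeftOf s p
  side {s} {p} p≉s with compare (px s) (px p)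
  ... | tri< s<p _ _ = inj₁ s<p
  ... | tri≈ _ s≈p _ = ⊥-elim (p≉s (sym s≈p))
  ... | tri> _ _ p<s = inj₂ p<s

  AngleLt⇒0<slopeDiff : ∀ {s p q} → AngleLt s p q → 0# < slopeDiff (p ⊖ s) (q ⊖ s)
  AngleLt⇒0<slopeDiff (inj₁ (s<p , s<q , 0<cross)) =
    *-pos (*-pos (x<y⇒0<y-x s<p) (x<y⇒0<y-x s<q)) 0<cross
  AngleLt⇒0<slopeDiff (inj₂ (inj₁ (p<s , q<s , 0<cross))) =
    *-pos (*-neg-neg (x<y⇒x-y<0 p<s) (x<y⇒x-y<0 q<s)) 0<cross
  AngleLt⇒0<slopeDiff (inj₂ (inj₂ (inj₁ (s<p , q<s , cross<0)))) =
    *-neg-neg (*-pos-neg (x<y⇒0<y-x s<p) (x<y⇒x-y<0 q<s)) cross<0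
  AngleLt⇒0<slopeDiff (inj₂ (inj₂ (inj₂ (p<s , s<q , cross<0)))) =
    *-neg-neg (*-neg-pos (x<y⇒x-y<0 p<s) (x<y⇒0<y-x s<q)) cross<0

  0<slopeDiff⇒AngleLt : ∀ {s p q} → 0# < slopeDiff (p ⊖ s) (q ⊖ s) → AngleLt s p q
  0<slopeDiff⇒AngleLt {s} {p} {q} 0<d with side {s} {p} p≉s | side {s} {q} q≉s
    where
    p≉s : ¬ px p ≈ px s
    p≉s = proj₁ (0<slopeDiff⇒px≉0 0<d) ∘ x≈y⇒x∙y⁻¹≈ε
    q≉s : ¬ px q ≈ px s
    q≉s = proj₂ (0<slopeDiff⇒px≉0 0<d) ∘ x≈y⇒x∙y⁻¹≈ε
  ... | inj₁ s<p | inj₁ s<q =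
    inj₁ (s<p , s<q , *-cancelˡ-pos (*-pos (x<y⇒0<y-x s<p) (x<y⇒0<y-x s<q)) 0<d)
  ... | inj₂ p<s | inj₂ q<s =
    inj₂ (inj₁ (p<s , q<s , *-cancelˡ-pos (*-neg-neg (x<y⇒x-y<0 p<s) (x<y⇒x-y<0 q<s)) 0<d))
  ... | inj₁ s<p | inj₂ q<s =
    inj₂ (inj₂ (inj₁ (s<p , q<s , *-cancelˡ-neg (*-pos-neg (x<y⇒0<y-x s<p) (x<y⇒x-y<0 q<s)) 0<d)))
  ... | inj₂ p<s | inj₁ s<q =
    inj₂ (inj₂ (inj₂ (p<s , s<q , *-cancelˡ-neg (*-neg-pos (x<y⇒x-y<0 p<s) (x<y⇒0<y-x s<q)) 0<d)))

  AngleLt-trans : ∀ {s} → Transitive (AngleLt s)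
  AngleLt-trans pq qr = 0<slopeDiff⇒AngleLt (slopeDiff-trans (AngleLt⇒0<slopeDiff pq) (AngleLt⇒0<slopeDiff qr))

  AngleLt-asym : ∀ {s p q} → AngleLt s p q → ¬ AngleLt s q p
  AngleLt-asym pq qp = slopeDiff-asym (AngleLt⇒0<slopeDiff pq) (AngleLt⇒0<slopeDiff qp)

  AngleLt-irrefl : ∀ {s p} → ¬ AngleLt s p p
  AngleLt-irrefl pp = AngleLt-asym pp pp

  AngleLt-total : ∀ {s p q} → ¬ px p ≈ px s → ¬ px q ≈ px s → ¬ Collinear s p q →
    AngleLt s p q ⊎ AngleLt s q p
  AngleLt-total p≉s q≉s ¬collinear =
    Sum.map 0<slopeDiff⇒AngleLt 0<slopeDiff⇒AngleLt
      (slopeDiff-total (p≉s ∘ x∙y⁻¹≈ε⇒x≈y _ _) (q≉s ∘ x∙y⁻¹≈ε⇒x≈y _ _) ¬collinear)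

module UpperLower {c ℓ₁ ℓ₂ : Level} (F : OrderedField c ℓ₁ ℓ₂) where
  open OrderedField F renaming (refl to ≈-refl)
  open Plane F
  open OrderedFieldProperties F
  open AngleOrder F

  ≡⇒px≈ : ∀ {p q} → p ≡ q → px p ≈ px q
  ≡⇒px≈ = reflexive ∘ cong px

  px-injective : ∀ {S p q} → NonVertical S → p ∈ S → q ∈ S → px p ≈ px q → p ≡ q
  px-injective _ (here refl) (here refl) _ = refl
  px-injective (p≉ ∷ _) (here refl) (there q∈) p≈q = ⊥-elim (All.lookup p≉ q∈ p≈q)
  px-injective (q≉ ∷ _) (there p∈) (here refl) p≈q = ⊥-elim (All.lookup q≉ p∈ (sym p≈q))
  px-injective (_ ∷ nv) (there p∈) (there q∈) p≈q = px-injective nv p∈ q∈ p≈q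

  ≢⇒px≉ : ∀ {S p q} → NonVertical S → p ∈ S → q ∈ S → p ≢ q → ¬ px p ≈ px q
  ≢⇒px≉ nv p∈ q∈ p≢q = p≢q ∘ px-injective nv p∈ q∈

  ≟-∈ : ∀ {S p q} → NonVertical S → p ∈ S → q ∈ S → Dec (p ≡ q)
  ≟-∈ {p = p} {q} nv p∈ q∈ = map′ (px-injective nv p∈ q∈) ≡⇒px≈ (px p ≟ px q)

  RightOf-tri : ∀ {S} → NonVertical S → TrichotomousOn RightOf S
  RightOf-tri nv {p} {q} p∈ q∈ with compare (px p) (px q)
  ... | tri< p<q p≉q q≮p = tri< p<q (p≉q ∘ ≡⇒px≈) q≮p
  ... | tri≈ p≮q p≈q q≮p = tri≈ p≮q (px-injective nv p∈ q∈ p≈q) q≮p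
  ... | tri> p≮q p≉q q<p = tri> p≮q (p≉q ∘ ≡⇒px≈) q<p

  other-point : ∀ {S} → NonVertical S → 2 ≤ length S → ∀ s → ∃ λ x → x ∈ S × ¬ px x ≈ px s
  other-point {_ ∷ []} _ (s≤s ()) _
  other-point {a ∷ b ∷ _} ((a≉b ∷ _) ∷ _) _ s with px a ≟ px s
  ... | yes a≈s = b , there (here refl) , λ b≈s → a≉b (trans a≈s (sym b≈s))
  ... | no a≉s = a , here refl , a≉s

  module Classification {S : List Point} (nv : NonVertical S) (gp : GeneralPosition S) where

    AngleLt-tri : ∀ {s p q} → s ∈ S → p ∈ S → q ∈ S → ¬ px p ≈ px s → ¬ px q ≈ px s →
      Tri (AngleLt s p q) (p ≡ q) (AngleLt s q p)
    AngleLt-tri s∈ p∈ q∈ p≉s q≉s with ≟-∈ nv p∈ q∈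
    ... | yes refl = tri≈ AngleLt-irrefl refl AngleLt-irrefl
    ... | no p≢q
      with AngleLt-total p≉s q≉s (gp s∈ p∈ q∈ (λ { refl → p≉s ≈-refl }) p≢q (λ { refl → q≉s ≈-refl }))
    ...   | inj₁ pq = tri< pq p≢q (AngleLt-asym pq)
    ...   | inj₂ qp = tri> (AngleLt-asym qp) p≢q qp

    others : Point → List Point
    others s = filter (λ q → ¬? (px q ≟ px s)) S

    ∈-others⁺ : ∀ s {q} → q ∈ S → ¬ px q ≈ px s → q ∈ others s
    ∈-others⁺ s = ∈-filter⁺ (λ q → ¬? (px q ≟ px s))

    ∈-others⁻ : ∀ s {q} → q ∈ others s → q ∈ S × ¬ px q ≈ px s
    ∈-others⁻ s = ∈-filter⁻ (λ q → ¬? (px q ≟ px s))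

    others-tri : ∀ {s} → s ∈ S → TrichotomousOn (AngleLt s) (others s)
    others-tri {s} s∈ u∈ v∈ with ∈-others⁻ s u∈ | ∈-others⁻ s v∈
    ... | u∈S , u≉s | v∈S , v≉s = AngleLt-tri s∈ u∈S v∈S u≉s v≉s

    Least-others⇒IsMinimizer : ∀ {s p} → s ∈ S → Least (AngleLt s) (others s) p → IsMinimizer S s p
    Least-others⇒IsMinimizer {s} s∈ (p∈ , p-least) =
        proj₁ (∈-others⁻ s p∈)
      , proj₂ (∈-others⁻ s p∈) ∘ ≡⇒px≈
      , λ q∈ q≢s → p-least (∈-others⁺ s q∈ (≢⇒px≉ nv q∈ s∈ q≢s))

    minimizer : 2 ≤ length S → ∀ {s} → s ∈ S → ∃ (IsMinimizer S s)
    minimizer 2≤∣S∣ {s} s∈ =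
      let x , x∈ , x≉s = other-point nv 2≤∣S∣ s
          p , p-least = least (AngleLt s) AngleLt-trans (∈-others⁺ s x∈ x≉s) (others-tri s∈)
      in p , Least-others⇒IsMinimizer s∈ p-least

    minimizer-unique : ∀ {s p p′} → s ∈ S → IsMinimizer S s p → IsMinimizer S s p′ → p ≡ p′
    minimizer-unique s∈ (p∈ , p≢s , p-min) (p′∈ , p′≢s , p′-min)
      with AngleLt-tri s∈ p∈ p′∈ (≢⇒px≉ nv p∈ s∈ p≢s) (≢⇒px≉ nv p′∈ s∈ p′≢s)
    ... | tri< _ p≢p′ p′≮p = ⊥-elim (p′≮p (p′-min p∈ p≢s p≢p′))
    ... | tri≈ _ p≡p′ _ = p≡p′
    ... | tri> p≮p′ p≢p′ _ = ⊥-elim (p≮p′ (p-min p′∈ p′≢s (λ { refl → p≢p′ refl })))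

    upper-or-lower : ∀ {s p} → s ∈ S → IsMinimizer S s p → Upper S s ⊎ Lower S s
    upper-or-lower {s} {p} s∈ p-min with px s <? px p
    ... | yes s<p = inj₁ (s∈ , p , p-min , s<p)
    ... | no s≮p = inj₂ (s∈ , p , p-min , s≮p)

    ¬upper×lower : ∀ {s} → Upper S s → Lower S s → ⊥
    ¬upper×lower {s} (s∈ , p , p-min , s<p) (_ , p′ , p′-min , s≮p′) =
      s≮p′ (subst (RightOf s) (minimizer-unique s∈ p-min p′-min) s<p)

    leftmost-upper : 2 ≤ length S → ∀ {m} → Least RightOf S m → Upper S m
    leftmost-upper 2≤∣S∣ (m∈ , m-least) =
      m∈ , Product.map₂ (λ { p-min@(p∈ , p≢m , _) → p-min , m-least p∈ p≢m }) (minimizer 2≤∣S∣ m∈)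

    rightmost-lower : 2 ≤ length S → ∀ {m} → Least LeftOf S m → Lower S m
    rightmost-lower 2≤∣S∣ (m∈ , m-least) =
      m∈ , Product.map₂ (λ { p-min@(p∈ , p≢m , _) → p-min , <-asym (m-least p∈ p≢m) }) (minimizer 2≤∣S∣ m∈)

    upper-exists : 2 ≤ length S → ∀ {x} → x ∈ S → ∃ (Upper S)
    upper-exists 2≤∣S∣ x∈ = Product.map₂ (leftmost-upper 2≤∣S∣) (least RightOf <-trans x∈ (RightOf-tri nv))

    lower-exists : 2 ≤ length S → ∀ {x} → x ∈ S → ∃ (Lower S)
    lower-exists 2≤∣S∣ x∈ =
      Product.map₂ (rightmost-lower 2≤∣S∣) (least LeftOf (flip <-trans) x∈ (TrichotomousOn-flip (RightOf-tri nv)))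

lemma5 : ∀ {c ℓ₁ ℓ₂ : Level} (F : OrderedField c ℓ₁ ℓ₂) (S : List (Plane.Point F)) →
    2 ≤ length S → Plane.NonVertical F S → Plane.GeneralPosition F S →
    (∀ {s} → s ∈ S → Plane.Upper F S s ⊎ Plane.Lower F S s)
    × (∀ {s} → Plane.Upper F S s → Plane.Lower F S s → ⊥)
    × (∃ λ s → Plane.Upper F S s)
    × (∃ λ s → Plane.Lower F S s)
lemma5 F (_ ∷ _) 2≤∣S∣ nv gp =
    (λ s∈ → upper-or-lower s∈ (proj₂ (minimizer 2≤∣S∣ s∈)))
  , ¬upper×lower
  , upper-exists 2≤∣S∣ (here refl)
  , lower-exists 2≤∣S∣ (here refl)
  where open UpperLower.Classification F nv gp
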